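{- Let $\mathcal{H}$ be a 3-uniform hypergraph containing no copy of $\mathcal{L}$, let $\mathcal{H}'$ be its 22-core, and let $Y$ be the set of vertices $y \in V(\mathcal{H}')$ with $\nu(Tr_{\mathcal{H}'}(y)) \ge 4$. Let $y \in Y$ and let $C$ be the vertex set of a connected component of $Tr_{\mathcal{H}'}(y)$ with at least 23 vertices. If $abc \in \mathcal{H}'$ and $abc \cap C \neq \varnothing$, then $y \in abc$.
   Context: The loose path $\mathcal{L}$ is $\{abc, cde, efg\}$ on seven distinct vertices. The 22-core is obtained by iteratively deleting vertices of degree less than 22 (with their triples) until all remaining vertices have degree at least 22. $Tr_{\mathcal{H}'}(v) = \{ e \setminus \{v\} : e \in \mathcal{H}', v \in e\}$ is the trace graph of $v$; $\nu$ is the matching number. -}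

module Defs where

open import Data.Nat using (ℕ; zero; suc; _≤ᵇ_; _≤_)
open import Data.Bool using (Bool; _∧_)
open import Data.Fin using (Fin)
open import Data.Fin.Subset using (Subset; ⁅_⁆; _∈_; _∉_; _⊆_; _∩_; _∪_; _-_; ∣_∣; Empty; Nonempty)
open import Data.Fin.Subset.Properties using (_∈?_; _⊆?_)
open import Data.Vec using (tabulate)
open import Data.List using (List; length; filter; map)
open import Data.List.Membership.Propositional using () renaming (_∈_ to _∈ₗ_)
open import Data.List.Relation.Unary.All using (All)
open import Data.List.Relation.Unary.Unique.Propositional using (Unique)
open import Data.List.Relation.Unary.AllPairs using (AllPairs)
open import Data.Product using (Σ; ∃; _×_; _,_)
open import Function.Definitions using (Injective)
open import Relation.Binary.PropositionalEquality using (_≡_)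
open import Relation.Nullary using (¬_; does)

record Hypergraph3 (n : ℕ) : Set where
  field
    edges    : List (Subset n)
    uniform  : All (λ e → ∣ e ∣ ≡ 3) edges
    distinct : Unique edges
open Hypergraph3 public

triple : ∀ {n} → Fin n → Fin n → Fin n → Subset n
triple a b c = ⁅ a ⁆ ∪ (⁅ b ⁆ ∪ ⁅ c ⁆)

-- H contains a copy of the loose path L = {abc, cde, efg} on 7 distinct vertices
-- (vertices a..g are f 0 .. f 6).
ContainsLoosePath : ∀ {n} → List (Subset n) → Set
ContainsLoosePath {n} E =
  Σ (Fin 7 → Fin n) λ f → Injective _≡_ _≡_ f
    × (triple (f (# 0)) (f (# 1)) (f (# 2)) ∈ₗ E)
    × (triple (f (# 2)) (f (# 3)) (f (# 4)) ∈ₗ E)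
    × (triple (f (# 4)) (f (# 5)) (f (# 6)) ∈ₗ E)
  where open import Data.Fin using (#_)

inducedEdges : ∀ {n} → List (Subset n) → Subset n → List (Subset n)
inducedEdges E S = filter (λ e → e ⊆? S) E

degree : ∀ {n} → List (Subset n) → Fin n → ℕ
degree E v = length (filter (λ e → v ∈? e) E)

coreStep : ∀ {n} → ℕ → List (Subset n) → Subset n → Subset n
coreStep k E S = tabulate λ v → does (v ∈? S) ∧ (k ≤ᵇ degree (inducedEdges E S) v)

iterateCore : ∀ {n} → ℕ → ℕ → List (Subset n) → Subset n → Subset n
iterateCore k zero    E S = S
iterateCore k (suc m) E S = iterateCore k m E (coreStep k E S)

fullSet : ∀ {n} → Subset n
fullSet = tabulate λ _ → Bool.true
  where import Data.Bool as Bool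

-- Vertex set of the k-core: iterated deletion starting from all vertices.
-- Each non-stationary round deletes at least one vertex, so n rounds reach the fixed point.
coreVertices : ∀ {n} → ℕ → Hypergraph3 n → Subset n
coreVertices {n} k H = iterateCore k n (edges H) fullSet

coreEdges : ∀ {n} → ℕ → Hypergraph3 n → List (Subset n)
coreEdges k H = inducedEdges (edges H) (coreVertices k H)

trace : ∀ {n} → List (Subset n) → Fin n → List (Subset n)
trace E v = map (λ e → e - v) (filter (λ e → v ∈? e) E)

Disjoint : ∀ {n} → Subset n → Subset n → Set
Disjoint p q = Empty (p ∩ q)

HasMatchingOfSize : ∀ {n} → ℕ → List (Subset n) → Set
HasMatchingOfSize k G =
  Σ (List _) λ M → All (_∈ₗ G) M × length M ≡ k × AllPairs Disjoint M

data Reach {n} (G : List (Subset n)) (u : Fin n) : Fin n → Set where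
  here : Reach G u u
  step : ∀ {w x} → Reach G u w → (⁅ w ⁆ ∪ ⁅ x ⁆) ∈ₗ G → Reach G u x

IsComponent : ∀ {n} → List (Subset n) → Subset n → Set
IsComponent G C = ∃ λ u → ∀ w → (w ∈ C → Reach G u w) × (Reach G u w → w ∈ C)

-- Let y ∉ A = abc be a triple of the 22-core H' of an L-free 3-graph, and suppose a
-- component C of Tr(y) with at least 23 vertices meets A.  Since |C| > |A|, a walk in C
-- from A to a vertex outside A has a step zx with z ∈ A, x ∉ A, so yzx ∈ H'.  For every
-- further trace edge st avoiding A ∪ {x}, the triples A, zxy, yst would form a loose path;
-- hence every trace edge meets A ∪ {x} ("forcing").  Forcing caps the matching number of
-- Tr(y) at 3: if four disjoint trace edges all met A, A would hold four distinct vertices;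
-- if one of them, e, avoids A, then e ∋ x, and every other matching edge lies inside A
-- (an edge leaving A would, by forcing, meet e), so two of them again give four vertices
-- of A.  This contradicts ν(Tr(y)) ≥ 4, so y ∈ abc.
module Submission where

open import Defs
open import Data.Nat using (ℕ; _≤_)
open import Data.Fin using (Fin)
open import Data.Fin.Subset using (Subset; _∈_; _∉_; _∩_; ∣_∣; Nonempty)
open import Data.List.Membership.Propositional using () renaming (_∈_ to _∈ₗ_)
open import Relation.Nullary using (¬_)

open import Data.Nat using (suc; _<_; z≤n; s≤s)
open import Data.Nat.Properties using (≤-trans; ≤-reflexive; suc-injective; n≮n; <⇒≱; m≤m+n)
open import Data.Fin using (_≟_)
import Data.Fin as Fin
open import Data.Fin.Subset using (inside; outside; ⁅_⁆; _∪_; _─_; _-_; _⊆_) renaming (⊥ to ∅)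
open import Data.Fin.Subset.Properties
  using (_∈?_; _⊆?_; nonempty?; drop-there; x∈⁅x⁆; x∈⁅y⁆⇒x≡y; x∉⁅y⁆⇒x≢y; ⊆-antisym; p⊆q⇒∣p∣≤∣q∣;
         x∈p∪q⁺; x∈p∪q⁻; x∈p∩q⁺; x∈p∩q⁻; ∪-comm; ∪-assoc; ∪-identityʳ; p─⊥≡p;
         x∈p∧x≢y⇒x∈p-y; x∈p∧x∉q⇒x∈p─q; x∈p⇒∣p-x∣<∣p∣)
open import Data.List using (List; []; _∷_; length)
import Data.List.Relation.Unary.All as All
open import Data.List.Relation.Unary.All using (All; []; _∷_)
open import Data.List.Relation.Unary.All.Properties using (filter⁺)
open import Data.List.Relation.Unary.AllPairs using (AllPairs; []; _∷_)
open import Data.List.Membership.Propositional.Properties using (∈-map⁻; ∈-filter⁻)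
open import Data.Vec using (Vec; _∷_; []; lookup; here; there)
import Data.Vec.Relation.Unary.All as VecAll
open import Data.Vec.Relation.Unary.All using ([]; _∷_)
open import Data.Vec.Relation.Unary.AllPairs using ([]; _∷_)
open import Data.Vec.Relation.Unary.Unique.Propositional using (Unique)
open import Data.Vec.Relation.Unary.Unique.Propositional.Properties using (lookup-injective)
open import Data.Vec.Relation.Unary.AllPairs.Properties using (++⁺)
open import Data.Product using (Σ; ∃; ∃₂; _×_; _,_; proj₁; proj₂; uncurry)
open import Data.Sum using (_⊎_; inj₁; inj₂; [_,_]′; fromInj₂)
import Data.Sum as Sum
open import Data.Empty using (⊥; ⊥-elim)
open import Function using (_∘_)
open import Relation.Nullary using (Dec; yes; no; ¬?; contradiction)
open import Relation.Nullary.Decidable using (decidable-stable)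
open import Relation.Unary using (Decidable)
open import Relation.Binary.PropositionalEquality using (_≡_; _≢_; refl; sym; trans; cong; subst; module ≡-Reasoning)

open ≡-Reasoning

private
  variable
    n k : ℕ
    p q A C : Subset n
    x y z s t w : Fin n

x∈p─q⁻ : x ∈ p ─ q → x ∈ p × x ∉ q
x∈p─q⁻ {p = inside ∷ _}  {q = outside ∷ _} here = here , λ ()
x∈p─q⁻ {x = Fin.zero} {p = _ ∷ _} {q = inside ∷ _} ()
x∈p─q⁻ {x = Fin.zero} {p = outside ∷ _} {q = outside ∷ _} ()
x∈p─q⁻ {p = _ ∷ _}       {q = _ ∷ _}       (there x∈p─q) =
  let (x∈p , x∉q) = x∈p─q⁻ x∈p─q in there x∈p , x∉q ∘ drop-there

x∈p-y⁻ : x ∈ p - y → x ∈ p × x ≢ y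
x∈p-y⁻ x∈p-y = let (x∈p , x∉⁅y⁆) = x∈p─q⁻ x∈p-y in x∈p , x∉⁅y⁆⇒x≢y x∉⁅y⁆

p≡⁅x⁆∪p-x : x ∈ p → p ≡ ⁅ x ⁆ ∪ (p - x)
p≡⁅x⁆∪p-x {x = x} {p = p} x∈p = ⊆-antisym into outof
  where
  into : p ⊆ ⁅ x ⁆ ∪ (p - x)
  into {w} w∈p with w ≟ x
  ... | yes refl = x∈p∪q⁺ (inj₁ (x∈⁅x⁆ x))
  ... | no w≢x   = x∈p∪q⁺ (inj₂ (x∈p∧x≢y⇒x∈p-y w∈p w≢x))

  outof : ⁅ x ⁆ ∪ (p - x) ⊆ p
  outof w∈ with x∈p∪q⁻ ⁅ x ⁆ (p - x) w∈
  ... | inj₁ w∈⁅x⁆ = subst (_∈ p) (sym (x∈⁅y⁆⇒x≡y x w∈⁅x⁆)) x∈p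
  ... | inj₂ w∈p-x = proj₁ (x∈p-y⁻ w∈p-x)

suc∣p-x∣≡∣p∣ : x ∈ p → suc ∣ p - x ∣ ≡ ∣ p ∣
suc∣p-x∣≡∣p∣ {p = inside ∷ p}  here        = cong (suc ∘ ∣_∣) (p─⊥≡p p)
suc∣p-x∣≡∣p∣ {p = inside ∷ _}  (there x∈p) = cong suc (suc∣p-x∣≡∣p∣ x∈p)
suc∣p-x∣≡∣p∣ {p = outside ∷ _} (there x∈p) = suc∣p-x∣≡∣p∣ x∈p

∣p-x∣≡k : x ∈ p → ∣ p ∣ ≡ suc k → ∣ p - x ∣ ≡ k
∣p-x∣≡k x∈p ∣p∣≡1+k = suc-injective (trans (suc∣p-x∣≡∣p∣ x∈p) ∣p∣≡1+k)

size⇒nonempty : ∣ p ∣ ≡ suc k → Nonempty p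
size⇒nonempty {p = inside ∷ _}  _ = Fin.zero , here
size⇒nonempty {p = outside ∷ _} ∣p∣≡1+k =
  let (x , x∈p) = size⇒nonempty ∣p∣≡1+k in Fin.suc x , there x∈p

∣p∣≡0⇒p≡∅ : ∣ p ∣ ≡ 0 → p ≡ ∅
∣p∣≡0⇒p≡∅ {p = []}          _     = refl
∣p∣≡0⇒p≡∅ {p = outside ∷ _} ∣p∣≡0 = cong (outside ∷_) (∣p∣≡0⇒p≡∅ ∣p∣≡0)

∣p∣≡2⇒pair : ∣ p ∣ ≡ 2 → ∃₂ λ s t → s ≢ t × s ∈ p × t ∈ p × p ≡ ⁅ s ⁆ ∪ ⁅ t ⁆
∣p∣≡2⇒pair {p = p} ∣p∣≡2 with size⇒nonempty ∣p∣≡2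
... | s , s∈p with size⇒nonempty (∣p-x∣≡k s∈p ∣p∣≡2)
... | t , t∈p-s =
  let (t∈p , t≢s) = x∈p-y⁻ t∈p-s in s , t , t≢s ∘ sym , s∈p , t∈p , p≡st
  where
  p-s-t≡∅ : p - s - t ≡ ∅
  p-s-t≡∅ = ∣p∣≡0⇒p≡∅ (∣p-x∣≡k t∈p-s (∣p-x∣≡k s∈p ∣p∣≡2))

  p≡st : p ≡ ⁅ s ⁆ ∪ ⁅ t ⁆
  p≡st = begin
    p                             ≡⟨ p≡⁅x⁆∪p-x s∈p ⟩
    ⁅ s ⁆ ∪ (p - s)               ≡⟨ cong (⁅ s ⁆ ∪_) (p≡⁅x⁆∪p-x t∈p-s) ⟩
    ⁅ s ⁆ ∪ (⁅ t ⁆ ∪ (p - s - t)) ≡⟨ cong (λ r → ⁅ s ⁆ ∪ (⁅ t ⁆ ∪ r)) p-s-t≡∅ ⟩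
    ⁅ s ⁆ ∪ (⁅ t ⁆ ∪ ∅)           ≡⟨ cong (⁅ s ⁆ ∪_) (∪-identityʳ ⁅ t ⁆) ⟩
    ⁅ s ⁆ ∪ ⁅ t ⁆                 ∎

rotate : (a b c : Fin n) → triple a b c ≡ triple b c a
rotate a b c = trans (∪-comm ⁅ a ⁆ (⁅ b ⁆ ∪ ⁅ c ⁆)) (∪-assoc ⁅ b ⁆ ⁅ c ⁆ ⁅ a ⁆)

∣A∣≡3⇒triple : ∣ A ∣ ≡ 3 → z ∈ A →
               ∃₂ λ p q → p ≢ q × p ∈ A - z × q ∈ A - z × A ≡ triple p q z
∣A∣≡3⇒triple {A = A} {z = z} ∣A∣≡3 z∈A with ∣p∣≡2⇒pair (∣p-x∣≡k z∈A ∣A∣≡3)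
... | p , q , p≢q , p∈A-z , q∈A-z , A-z≡pq = p , q , p≢q , p∈A-z , q∈A-z , (begin
  A                ≡⟨ p≡⁅x⁆∪p-x z∈A ⟩
  ⁅ z ⁆ ∪ (A - z)  ≡⟨ cong (⁅ z ⁆ ∪_) A-z≡pq ⟩
  triple z p q     ≡⟨ rotate z p q ⟩
  triple p q z     ∎)

distinct⇒length≤∣p∣ : ∀ {xs : List (Fin n)} → AllPairs _≢_ xs → All (_∈ p) xs → length xs ≤ ∣ p ∣
distinct⇒length≤∣p∣ [] [] = z≤n
distinct⇒length≤∣p∣ (x≢xs ∷ distinct) (x∈p ∷ xs⊆p) =
  ≤-trans (s≤s (distinct⇒length≤∣p∣ distinct xs⊆p-x)) (x∈p⇒∣p-x∣<∣p∣ x∈p)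
  where
  xs⊆p-x = All.zipWith (λ (x≢w , w∈p) → x∈p∧x≢y⇒x∈p-y w∈p (x≢w ∘ sym)) (x≢xs , xs⊆p)

outsideElement : ∣ p ∣ < ∣ q ∣ → ∃ λ w → w ∈ q × w ∉ p
outsideElement {p = p} {q = q} ∣p∣<∣q∣ with nonempty? (q ─ p)
... | yes (w , w∈q─p) = w , x∈p─q⁻ w∈q─p
... | no q─p-empty    = contradiction (p⊆q⇒∣p∣≤∣q∣ q⊆p) (<⇒≱ ∣p∣<∣q∣)
  where
  q⊆p : q ⊆ p
  q⊆p {w} w∈q = decidable-stable (w ∈? p) λ w∉p → q─p-empty (w , x∈p∧x∉q⇒x∈p─q w∈q w∉p)

-- An edge of a graph, as an ordered pair of vertices; pairSet is the 2-set it denotes.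
Pair : ℕ → Set
Pair n = Fin n × Fin n

pairSet : Pair n → Subset n
pairSet (s , t) = ⁅ s ⁆ ∪ ⁅ t ⁆

_∈ₚ_ : Fin n → Pair n → Set
w ∈ₚ e = w ≡ proj₁ e ⊎ w ≡ proj₂ e

Meets : Pair n → Subset n → Set
Meets e A = ∃ λ w → w ∈ₚ e × w ∈ A

Apart : Pair n → Pair n → Set
Apart e e' = ∀ {w w'} → w ∈ₚ e → w' ∈ₚ e' → w ≢ w'

apart-sym : ∀ {e e' : Pair n} → Apart e e' → Apart e' e
apart-sym apart w∈e' w'∈e w≡w' = apart w'∈e w∈e' (sym w≡w')

apart-swap : ∀ {e : Pair n} → Apart e (s , t) → Apart e (t , s)
apart-swap apart w∈e w'∈ts = apart w∈e (Sum.swap w'∈ts)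

disjoint⇒apart : ∀ {e e' : Pair n} → Disjoint (pairSet e) (pairSet e') → Apart e e'
disjoint⇒apart disjoint {w} w∈e w∈e' refl = disjoint (w , x∈p∩q⁺ (inPair w∈e , inPair w∈e'))
  where
  inPair : ∀ {e} → w ∈ₚ e → w ∈ pairSet e
  inPair (inj₁ refl) = x∈p∪q⁺ (inj₁ (x∈⁅x⁆ _))
  inPair (inj₂ refl) = x∈p∪q⁺ (inj₂ (x∈⁅x⁆ _))

record TraceEdge (E : List (Subset n)) (y s t : Fin n) : Set where
  field
    y≢s      : y ≢ s
    y≢t      : y ≢ t
    s≢t      : s ≢ t
    triple∈E : triple y s t ∈ₗ E
open TraceEdge

traceEdge-sym : ∀ {E : List (Subset n)} → TraceEdge E y s t → TraceEdge E y t s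
traceEdge-sym {y = y} {s = s} {t = t} {E = E} st = record
  { y≢s = y≢t st ; y≢t = y≢s st ; s≢t = s≢t st ∘ sym
  ; triple∈E = subst (_∈ₗ E) (cong (⁅ y ⁆ ∪_) (∪-comm ⁅ s ⁆ ⁅ t ⁆)) (triple∈E st) }

traceMember : ∀ {E : List (Subset n)} {m} → m ∈ₗ trace E y → ∃ λ e → e ∈ₗ E × y ∈ e × m ≡ e - y
traceMember {y = y} m∈T with ∈-map⁻ (_- y) m∈T
... | e , e∈E∋y , refl = let (e∈E , y∈e) = ∈-filter⁻ (y ∈?_) e∈E∋y in e , e∈E , y∈e , refl

traceEdgeFrom : ∀ {E : List (Subset n)} {e} → e ∈ₗ E → y ∈ e → e - y ≡ ⁅ s ⁆ ∪ ⁅ t ⁆ → s ≢ t →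
                TraceEdge E y s t
traceEdgeFrom {y = y} {s = s} {t = t} {E = E} e∈E y∈e e-y≡st s≢t = record
  { y≢s = λ y≡s → proj₂ (x∈p-y⁻ (inRest (inj₁ (x∈⁅x⁆ s)))) (sym y≡s)
  ; y≢t = λ y≡t → proj₂ (x∈p-y⁻ (inRest (inj₂ (x∈⁅x⁆ t)))) (sym y≡t)
  ; s≢t = s≢t
  ; triple∈E = subst (_∈ₗ E) (trans (p≡⁅x⁆∪p-x y∈e) (cong (⁅ y ⁆ ∪_) e-y≡st)) e∈E }
  where
  inRest : ∀ {w} → w ∈ ⁅ s ⁆ ⊎ w ∈ ⁅ t ⁆ → w ∈ _
  inRest w∈ = subst (_ ∈_) (sym e-y≡st) (x∈p∪q⁺ w∈)

pairInTrace : ∀ {E : List (Subset n)} → ⁅ s ⁆ ∪ ⁅ t ⁆ ∈ₗ trace E y → s ≢ t → TraceEdge E y s t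
pairInTrace st∈T s≢t with traceMember st∈T
... | e , e∈E , y∈e , st≡e-y = traceEdgeFrom e∈E y∈e (sym st≡e-y) s≢t

traceEdge : ∀ {E : List (Subset n)} {m} → All (λ e → ∣ e ∣ ≡ 3) E → m ∈ₗ trace E y →
            Σ (Pair n) λ e → m ≡ pairSet e × uncurry (TraceEdge E y) e
traceEdge uniform m∈T with traceMember m∈T
... | e , e∈E , y∈e , refl with ∣p∣≡2⇒pair (∣p-x∣≡k y∈e (All.lookup uniform e∈E))
... | s , t , s≢t , _ , _ , e-y≡st = (s , t) , e-y≡st , traceEdgeFrom e∈E y∈e e-y≡st s≢t

loosePath : ∀ {E : List (Subset n)} {a b c d e f g} → Unique (a ∷ b ∷ c ∷ d ∷ e ∷ f ∷ g ∷ []) →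
            triple a b c ∈ₗ E → triple c d e ∈ₗ E → triple e f g ∈ₗ E → ContainsLoosePath E
loosePath {a = a} {b} {c} {d} {e} {f} {g} distinct abc cde efg =
  lookup (a ∷ b ∷ c ∷ d ∷ e ∷ f ∷ g ∷ []) , (λ {i} {j} → lookup-injective distinct i j) , abc , cde , efg

loosePath-mono : ∀ {E F : List (Subset n)} → (∀ {e} → e ∈ₗ E → e ∈ₗ F) →
                 ContainsLoosePath E → ContainsLoosePath F
loosePath-mono E⊆F (f , injective , abc , cde , efg) = f , injective , E⊆F abc , E⊆F cde , E⊆F efg

module _ {E : List (Subset n)} (noPath : ¬ ContainsLoosePath E)
         (A∈E : A ∈ₗ E) (∣A∣≡3 : ∣ A ∣ ≡ 3) (y∉A : y ∉ A) where

  private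
    separated : ∀ {i j} {as : Vec (Fin n) i} {bs : Vec (Fin n) j} →
                VecAll.All (_∈ A) as → VecAll.All (_∉ A) bs → VecAll.All (λ a → VecAll.All (a ≢_) bs) as
    separated as∈A bs∉A =
      VecAll.map (λ a∈A → VecAll.map (λ b∉A a≡b → b∉A (subst (_∈ A) a≡b a∈A)) bs∉A) as∈A

  -- The key observation: for a trace edge zx leaving A and a trace edge st avoiding
  -- A ∪ {x}, the triples A = pqz, zxy, yst form a loose path.
  looseFromCrossing : z ∈ A → x ∉ A → TraceEdge E y z x → TraceEdge E y s t →
                      s ∉ A → t ∉ A → s ≢ x → t ≢ x → ContainsLoosePath E
  looseFromCrossing {z = z} {x = x} {s = s} {t = t} z∈A x∉A zx st s∉A t∉A s≢x t≢x
    with ∣A∣≡3⇒triple ∣A∣≡3 z∈A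
  ... | p , q , p≢q , p∈A-z , q∈A-z , A≡pqz =
    loosePath (++⁺ inA outA (separated (p∈A ∷ q∈A ∷ z∈A ∷ []) (x∉A ∷ y∉A ∷ s∉A ∷ t∉A ∷ [])))
      (subst (_∈ₗ E) A≡pqz A∈E)
      (subst (_∈ₗ E) (rotate y z x) (triple∈E zx))
      (triple∈E st)
    where
    p∈A = proj₁ (x∈p-y⁻ p∈A-z)
    q∈A = proj₁ (x∈p-y⁻ q∈A-z)
    inA : Unique (p ∷ q ∷ z ∷ [])
    inA = (p≢q ∷ proj₂ (x∈p-y⁻ p∈A-z) ∷ []) ∷ (proj₂ (x∈p-y⁻ q∈A-z) ∷ []) ∷ [] ∷ []
    outA : Unique (x ∷ y ∷ s ∷ t ∷ [])
    outA = (y≢t zx ∘ sym ∷ s≢x ∘ sym ∷ t≢x ∘ sym ∷ [])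
         ∷ (y≢s st ∷ y≢t st ∷ []) ∷ (s≢t st ∷ []) ∷ [] ∷ []

  forcing : ∀ {e} → z ∈ A → x ∉ A → TraceEdge E y z x → uncurry (TraceEdge E y) e →
            Meets e A ⊎ x ∈ₚ e
  forcing {x = x} {e = s , t} z∈A x∉A zx st with s ∈? A | t ∈? A | s ≟ x | t ≟ x
  ... | yes s∈A | _       | _       | _       = inj₁ (s , inj₁ refl , s∈A)
  ... | _       | yes t∈A | _       | _       = inj₁ (t , inj₂ refl , t∈A)
  ... | _       | _       | yes s≡x | _       = inj₂ (inj₁ (sym s≡x))
  ... | _       | _       | _       | yes t≡x = inj₂ (inj₂ (sym t≡x))
  ... | no s∉A  | no t∉A  | no s≢x  | no t≢x  =
    ⊥-elim (noPath (looseFromCrossing z∈A x∉A zx st s∉A t∉A s≢x t≢x))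

module _ {A : Subset n} (∣A∣≤3 : ∣ A ∣ ≤ 3) {Edge : Pair n → Set}
         (edge-sym : ∀ {s t} → Edge (s , t) → Edge (t , s))
         (edge-proper : ∀ {s t} → Edge (s , t) → s ≢ t)
         (forces : ∀ {z x e} → z ∈ A → x ∉ A → Edge (z , x) → Edge e → Meets e A ⊎ x ∈ₚ e)
         {z₀ x₀ : Fin n} (z₀∈A : z₀ ∈ A) (x₀∉A : x₀ ∉ A) (leaving : Edge (z₀ , x₀)) where

  private
    fourInA : ∀ {a b c d} → a ∈ A → b ∈ A → c ∈ A → d ∈ A →
              a ≢ b → a ≢ c → a ≢ d → b ≢ c → b ≢ d → c ≢ d → ⊥
    fourInA a∈A b∈A c∈A d∈A a≢b a≢c a≢d b≢c b≢d c≢d = n≮n 3 (≤-trans four≤∣A∣ ∣A∣≤3)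
      where
      four≤∣A∣ = distinct⇒length≤∣p∣
        ((a≢b ∷ a≢c ∷ a≢d ∷ []) ∷ (b≢c ∷ b≢d ∷ []) ∷ (c≢d ∷ []) ∷ [] ∷ [])
        (a∈A ∷ b∈A ∷ c∈A ∷ d∈A ∷ [])

    meets? : (e : Pair n) → Dec (Meets e A)
    meets? (s , t) with s ∈? A | t ∈? A
    ... | yes s∈A | _       = yes (s , inj₁ refl , s∈A)
    ... | no _    | yes t∈A = yes (t , inj₂ refl , t∈A)
    ... | no s∉A  | no t∉A  = no λ { (_ , inj₁ refl , s∈A) → s∉A s∈A
                                   ; (_ , inj₂ refl , t∈A) → t∉A t∈A }

  module Avoiding {e : Pair n} (avoids : ¬ Meets e A) (edge : Edge e) where

    x₀∈e : x₀ ∈ₚ e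
    x₀∈e = fromInj₂ (⊥-elim ∘ avoids) (forces z₀∈A x₀∉A leaving edge)

    -- An edge apart from e with one end in A has its other end in A, since otherwise it
    -- leaves A and forcing makes e meet A or contain that end.
    otherEnd : ∀ {v} → Apart e (w , v) → Edge (w , v) → w ∈ A → v ∈ A
    otherEnd {v = v} apart wv w∈A = decidable-stable (v ∈? A) λ v∉A →
      [ avoids , (λ v∈e → apart v∈e (inj₂ refl) refl) ]′ (forces w∈A v∉A wv edge)

    -- Every edge apart from e lies inside A: it meets A, as it misses x₀ ∈ e.
    liesInA : ∀ {e'} → Apart e e' → Edge e' → proj₁ e' ∈ A × proj₂ e' ∈ A
    liesInA {s , t} apart st with forces z₀∈A x₀∉A leaving st
    ... | inj₂ x₀∈e'               = ⊥-elim (apart x₀∈e x₀∈e' refl)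
    ... | inj₁ (_ , inj₁ refl , s∈A) = s∈A , otherEnd apart st s∈A
    ... | inj₁ (_ , inj₂ refl , t∈A) = otherEnd (apart-swap apart) (edge-sym st) t∈A , t∈A

    -- Two further mutually apart edges would thus give four distinct vertices of A.
    noTwoMore : ∀ {e₁ e₂} → Edge e₁ → Edge e₂ → Apart e e₁ → Apart e e₂ → Apart e₁ e₂ → ⊥
    noTwoMore E₁ E₂ apart₁ apart₂ apart₁₂ =
      let (s₁∈A , t₁∈A) = liesInA apart₁ E₁
          (s₂∈A , t₂∈A) = liesInA apart₂ E₂
      in fourInA s₁∈A t₁∈A s₂∈A t₂∈A (edge-proper E₁)
           (apart₁₂ (inj₁ refl) (inj₁ refl)) (apart₁₂ (inj₁ refl) (inj₂ refl))
           (apart₁₂ (inj₂ refl) (inj₁ refl)) (apart₁₂ (inj₂ refl) (inj₂ refl)) (edge-proper E₂)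

  -- If one of the four edges avoids A, the Avoiding argument applies to it and two others;
  -- otherwise each meets A, at vertices that are distinct as the edges are apart.
  noFourApartEdges : ∀ {e₁ e₂ e₃ e₄} → Edge e₁ → Edge e₂ → Edge e₃ → Edge e₄ →
                     Apart e₁ e₂ → Apart e₁ e₃ → Apart e₁ e₄ →
                     Apart e₂ e₃ → Apart e₂ e₄ → Apart e₃ e₄ → ⊥
  noFourApartEdges {e₁} {e₂} {e₃} {e₄} E₁ E₂ E₃ E₄ a₁₂ a₁₃ a₁₄ a₂₃ a₂₄ a₃₄
    with meets? e₁ | meets? e₂ | meets? e₃ | meets? e₄
  ... | no avoids | _ | _ | _ = Avoiding.noTwoMore avoids E₁ E₂ E₃ a₁₂ a₁₃ a₂₃
  ... | _ | no avoids | _ | _ = Avoiding.noTwoMore avoids E₂ E₁ E₃ (apart-sym a₁₂) a₂₃ a₁₃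
  ... | _ | _ | no avoids | _ = Avoiding.noTwoMore avoids E₃ E₁ E₂ (apart-sym a₁₃) (apart-sym a₂₃) a₁₂
  ... | _ | _ | _ | no avoids = Avoiding.noTwoMore avoids E₄ E₁ E₂ (apart-sym a₁₄) (apart-sym a₂₄) a₁₂
  ... | yes (_ , w₁∈e₁ , w₁∈A) | yes (_ , w₂∈e₂ , w₂∈A)
      | yes (_ , w₃∈e₃ , w₃∈A) | yes (_ , w₄∈e₄ , w₄∈A) =
    fourInA w₁∈A w₂∈A w₃∈A w₄∈A (a₁₂ w₁∈e₁ w₂∈e₂) (a₁₃ w₁∈e₁ w₃∈e₃) (a₁₄ w₁∈e₁ w₄∈e₄)
            (a₂₃ w₂∈e₂ w₃∈e₃) (a₂₄ w₂∈e₂ w₄∈e₄) (a₃₄ w₃∈e₃ w₄∈e₄)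

noMatchingOfSize4 : ∀ {E : List (Subset n)} → All (λ e → ∣ e ∣ ≡ 3) E → ¬ ContainsLoosePath E →
                    A ∈ₗ E → y ∉ A → z ∈ A → x ∉ A → TraceEdge E y z x →
                    ¬ HasMatchingOfSize 4 (trace E y)
noMatchingOfSize4 uniform noPath A∈E y∉A z∈A x∉A zx
  ( _ ∷ _ ∷ _ ∷ _ ∷ []
  , m₁∈T ∷ m₂∈T ∷ m₃∈T ∷ m₄∈T ∷ []
  , refl
  , (d₁₂ ∷ d₁₃ ∷ d₁₄ ∷ []) ∷ (d₂₃ ∷ d₂₄ ∷ []) ∷ (d₃₄ ∷ []) ∷ [] ∷ [])
  with traceEdge uniform m₁∈T | traceEdge uniform m₂∈T | traceEdge uniform m₃∈T | traceEdge uniform m₄∈T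
... | _ , refl , E₁ | _ , refl , E₂ | _ , refl , E₃ | _ , refl , E₄ =
  noFourApartEdges (≤-reflexive ∣A∣≡3) traceEdge-sym s≢t
    (forcing noPath A∈E ∣A∣≡3 y∉A) z∈A x∉A zx E₁ E₂ E₃ E₄
    (disjoint⇒apart d₁₂) (disjoint⇒apart d₁₃) (disjoint⇒apart d₁₄)
    (disjoint⇒apart d₂₃) (disjoint⇒apart d₂₄) (disjoint⇒apart d₃₄)
  where
  ∣A∣≡3 = All.lookup uniform A∈E

leavingStep : ∀ {G : List (Subset n)} {P : Fin n → Set} → Decidable P → ∀ {u v} →
              Reach G u v → P u → ¬ P v → ∃₂ λ s t → P s × ¬ P t × ⁅ s ⁆ ∪ ⁅ t ⁆ ∈ₗ G
leavingStep P? here Pu ¬Pu = ⊥-elim (¬Pu Pu)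
leavingStep P? (step {w} walk wv∈G) Pu ¬Pv with P? w
... | yes Pw  = w , _ , Pw , ¬Pv , wv∈G
... | no ¬Pw  = leavingStep P? walk Pu ¬Pw

componentExit : ∀ {G : List (Subset n)} {a} → IsComponent G C → a ∈ A → a ∈ C → w ∉ A → w ∈ C →
                ∃₂ λ z x → z ∈ A × x ∉ A × (⁅ z ⁆ ∪ ⁅ x ⁆ ∈ₗ G ⊎ ⁅ x ⁆ ∪ ⁅ z ⁆ ∈ₗ G)
componentExit {A = A} {w = w} {a = a} (u , reach) a∈A a∈C w∉A w∈C with u ∈? A
... | yes u∈A =
  let (z , x , z∈A , x∉A , zx∈G) = leavingStep (_∈? A) (proj₁ (reach w) w∈C) u∈A w∉A
  in z , x , z∈A , x∉A , inj₁ zx∈G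
... | no u∉A =
  let (x , z , x∉A , ¬z∉A , xz∈G) =
        leavingStep (λ v → ¬? (v ∈? A)) (proj₁ (reach a) a∈C) u∉A (λ a∉A → a∉A a∈A)
  in z , x , decidable-stable (z ∈? A) ¬z∉A , x∉A , inj₂ xz∈G

leavingTraceEdge : ∀ {E : List (Subset n)} → IsComponent (trace E y) C → Nonempty (A ∩ C) →
                   ∣ A ∣ < ∣ C ∣ → ∃₂ λ z x → z ∈ A × x ∉ A × TraceEdge E y z x
leavingTraceEdge {C = C} {A = A} component (a , a∈A∩C) ∣A∣<∣C∣ =
  let (a∈A , a∈C)                 = x∈p∩q⁻ A C a∈A∩C
      (w , w∈C , w∉A)             = outsideElement ∣A∣<∣C∣
      (z , x , z∈A , x∉A , zx∈T) = componentExit component a∈A a∈C w∉A w∈C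
      z≢x = λ z≡x → x∉A (subst (_∈ A) z≡x z∈A)
  in z , x , z∈A , x∉A
   , [ (λ zx∈T → pairInTrace zx∈T z≢x)
     , (λ xz∈T → traceEdge-sym (pairInTrace xz∈T (z≢x ∘ sym))) ]′ zx∈T

coreEdges⊆edges : ∀ {k} (H : Hypergraph3 n) {e} → e ∈ₗ coreEdges k H → e ∈ₗ edges H
coreEdges⊆edges {k = k} H = proj₁ ∘ ∈-filter⁻ (_⊆? coreVertices k H)

-- If y ∉ abc, a trace edge leaves abc inside C (as |C| ≥ 23 > 3 = |abc|), which caps
-- ν(Tr(y)) below 4 in the L-free, 3-uniform core; this contradicts the matching.
mainTheorem10 : ∀ {n} (H : Hypergraph3 n) → ¬ ContainsLoosePath (edges H)
    → (y : Fin n) → y ∈ coreVertices 22 H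
    → HasMatchingOfSize 4 (trace (coreEdges 22 H) y)
    → (C : Subset n) → IsComponent (trace (coreEdges 22 H) y) C → 23 ≤ ∣ C ∣
    → (abc : Subset n) → abc ∈ₗ coreEdges 22 H → Nonempty (abc ∩ C)
    → y ∈ abc
mainTheorem10 H noPath y _ matching C component 23≤∣C∣ abc abc∈core abc∩C with y ∈? abc
... | yes y∈abc = y∈abc
... | no y∉abc =
  let ∣abc∣≡3 = All.lookup (uniform H) (coreEdges⊆edges H abc∈core)
      ∣abc∣<∣C∣ = subst (_< ∣ C ∣) (sym ∣abc∣≡3) (≤-trans (m≤m+n 4 19) 23≤∣C∣)
      (z , x , z∈abc , x∉abc , zx) = leavingTraceEdge component abc∩C ∣abc∣<∣C∣
  in ⊥-elim (noMatchingOfSize4 (filter⁺ _ (uniform H)) (noPath ∘ loosePath-mono (coreEdges⊆edges H))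
                               abc∈core y∉abc z∈abc x∉abc zx matching)
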